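{- Let $r$ be a positive integer and let $\{m\}_r$ ($m\ge 0$) be the $r$-Lucas polynomials, with the convention $\{k\}_r=0$ for integers $k<0$. Then $\{0\}_r=0$, $\{i\}_r=s_1^{i-1}$ for $1\le i\le r$, and for every integer $m>r$, $$\{m\}_r=\{m-r\}_r\, s_r+\{m-2r\}_r\, s_{2r}.$$ Furthermore, as formal power series in $x$ with coefficients in $\mathbb{Z}[s_1,s_2,\dots]$, $$\sum_{k\ge 0}\{k\}_r x^k=\frac{x+s_1x^2+s_1^2x^3+\cdots+s_1^{r-1}x^{r}}{1-s_r x^r-s_{2r}x^{2r}}.$$
   Context: Let $s_1,s_2,\dots$ be commuting indeterminates and $\mathbb{Z}[S]=\mathbb{Z}[s_1,s_2,\dots]$. For each $i\ge1$ let $\tau_i$ be a tile of length $i$. A tiling word of a nonnegative integer $k$ is a finite word $\tau_{i_1}\tau_{i_2}\cdots\tau_{i_j}$ (order matters) with $i_1+\cdots+i_j=k$; the empty word is the unique tiling word of $0$. Its weight is $\mathrm{wt}(\tau_{i_1}\cdots\tau_{i_j})=s_{i_1}s_{i_2}\cdots s_{i_j}$. Here $m \bmod r$ denotes the remainder in $\{0,1,\dots,r-1\}$. For $m\ge0$, $\Delta_{m,r}$ is the set of tiling words of $m$ that consist of exactly $(m\bmod r)$ tiles $\tau_1$ followed by tiles from $\{\tau_r,\tau_{2r}\}$ in any order. The $r$-Lucas polynomials are defined by $\{0\}_r=0$ and $\{m+1\}_r=\sum_{T\in\Delta_{m,r}}\mathrm{wt}(T)$ for $m\ge 0$ (so $\{1\}_r=1$).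 -}

module Defs where

open import Level using (Level)
open import Algebra.Bundles using (CommutativeRing)
open import Data.Nat using (ℕ; zero; suc; _≟_; NonZero)
open import Data.Nat.DivMod using (_%_; _/_)
import Data.Nat as ℕ
open import Data.Integer using (ℤ; +_; -[1+_])
open import Data.List using (List; []; _∷_; map; _++_; replicate; foldr; concatMap)
open import Relation.Nullary using (yes; no)

-- A tiling word is a list of tile lengths: the word τ_{i1}⋯τ_{ij} is the list i1 ∷ ⋯ ∷ ij ∷ [].
TilingWord : Set
TilingWord = List ℕ

-- All words over the tiles {τ_a, τ_b} whose tiles are used q times in total
-- counted with multiplicity 1 for τ_a and 2 for τ_b, i.e. words over {τ_r, τ_2r}
-- of total length q·r when a = r, b = 2r.
words12 : ℕ → ℕ → ℕ → List TilingWord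
words12 a b zero = [] ∷ []
words12 a b (suc zero) = (a ∷ []) ∷ []
words12 a b (suc (suc q)) = map (a ∷_) (words12 a b (suc q)) ++ map (b ∷_) (words12 a b q)

-- Δ_{m,r}: the tiling words of m consisting of (m mod r) tiles τ_1 followed by
-- tiles from {τ_r, τ_2r} in any order (enumerated without repetition).
Δ : (m r : ℕ) → .{{NonZero r}} → List TilingWord
Δ m r = map (replicate (m % r) 1 ++_) (words12 r (2 ℕ.* r) (m / r))

module Lucas {c ℓ : Level} (R : CommutativeRing c ℓ) (s : ℕ → CommutativeRing.Carrier R) where
  open CommutativeRing R

  pow : Carrier → ℕ → Carrier
  pow x zero = 1#
  pow x (suc n) = x * pow x n

  wt : TilingWord → Carrier
  wt w = foldr (λ i acc → s i * acc) 1# w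

  sumL : List Carrier → Carrier
  sumL = foldr _+_ 0#

  luc : (r : ℕ) → .{{NonZero r}} → ℕ → Carrier
  luc r zero = 0#
  luc r (suc m) = sumL (map wt (Δ m r))

  lucℤ : (r : ℕ) → .{{NonZero r}} → ℤ → Carrier
  lucℤ r (+ m) = luc r m
  lucℤ r -[1+ _ ] = 0#

  -- formal power series in x: coefficient sequences
  Series : Set c
  Series = ℕ → Carrier

  sumTo : ℕ → (ℕ → Carrier) → Carrier
  sumTo zero f = 0#
  sumTo (suc n) f = sumTo n f + f n

  _⋆_ : Series → Series → Series
  (f ⋆ g) k = sumTo (suc k) (λ i → f i * g (k Data.Nat.∸ i))

  _⊕_ : Series → Series → Series
  (f ⊕ g) k = f k + g k

  _⊖_ : Series → Series → Series
  (f ⊖ g) k = f k - g k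

  mono : Carrier → ℕ → Series
  mono a n k with k ≟ n
  ... | yes _ = a
  ... | no _ = 0#

  genFun : (r : ℕ) → .{{NonZero r}} → Series
  genFun r k = luc r k

  -- numerator x + s_1 x^2 + ⋯ + s_1^{r-1} x^r = Σ_{i<r} s_1^i x^{i+1}
  numer : ℕ → Series
  numer r k = sumTo r (λ i → mono (pow (s 1) i) (suc i) k)

  denom : ℕ → Series
  denom r = (mono 1# 0 ⊖ mono (s r) r) ⊖ mono (s (2 ℕ.* r)) (2 ℕ.* r)

-- Splitting off the leading run of τ₁'s, {j + q r + 1}_r = s₁^j W_q for 0 ≤ j < r, where W_q is
-- the total weight of the words over {τ_r, τ_2r} with q "units" (τ_2r counting twice).
-- Sorting those words by their first tile gives W_{q+2} = s_r W_{q+1} + s_2r W_q with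
-- W_0 = 1 and W_1 = s_r, which is the recurrence once it is multiplied by s₁^j.  The
-- generating-function identity is the recurrence read coefficientwise: the coefficient of x^k
-- in (Σ {m}_r x^m)(1 - s_r x^r - s_2r x^2r) is {k}_r - {k-r}_r s_r - {k-2r}_r s_2r, which
-- vanishes for k > r and equals s₁^(k-1) = [x^k] numerator for k ≤ r.
module Submission where

open import Defs
open import Level using (Level)
open import Algebra.Bundles using (CommutativeRing)
open import Data.Nat using (ℕ; zero; suc; _≤_; _<_; _∸_; NonZero; z≤n; s≤s; _≟_; _≤?_)
import Data.Nat as ℕ
import Data.Nat.Properties as ℕₚ
open import Data.Nat.DivMod using (_%_; _/_)
import Data.Nat.DivMod as DivMod
open import Data.Nat.Divisibility using (n∣m*n)
import Data.Nat.Solver as ℕSolver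
import Data.Integer as ℤ
open import Data.Integer using (+_)
import Data.Integer.Properties as ℤₚ
open import Data.Product using (_×_; _,_)
open import Data.List using (List; []; _∷_; map; _++_; replicate)
open import Data.Maybe using (nothing)
open import Data.Empty using (⊥-elim)
open import Relation.Nullary using (yes; no)
open import Function using (_∘_)
open import Relation.Binary.PropositionalEquality as ≡ using (_≡_; _≢_)
open import Tactic.RingSolver using (solve-∀)
open import Tactic.RingSolver.Core.AlmostCommutativeRing using (AlmostCommutativeRing; fromCommutativeRing)
import Algebra.Properties.Ring as RingProperties

module _ (r : ℕ) .{{_ : NonZero r}} {j : ℕ} (j<r : j < r) (q : ℕ) where

  [j+q*r]%r≡j : (j ℕ.+ q ℕ.* r) % r ≡ j
  [j+q*r]%r≡j = ≡.trans (DivMod.[m+kn]%n≡m%n j q r) (DivMod.m<n⇒m%n≡m j<r)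

  [j+q*r]/r≡q : (j ℕ.+ q ℕ.* r) / r ≡ q
  [j+q*r]/r≡q = ≡.trans (DivMod.+-distrib-/-∣ʳ j (n∣m*n q))
                        (≡.cong₂ ℕ._+_ (DivMod.m<n⇒m/n≡0 j<r) (DivMod.m*n/n≡m q r))

module _ (j q r : ℕ) where
  open ℕSolver.+-*-Solver

  1+[j+[1+q]*r]≡1+[j+q*r]+r : suc (j ℕ.+ suc q ℕ.* r) ≡ suc (j ℕ.+ q ℕ.* r) ℕ.+ r
  1+[j+[1+q]*r]≡1+[j+q*r]+r =
    solve 3 (λ j q r → con 1 :+ (j :+ (con 1 :+ q) :* r) := (con 1 :+ (j :+ q :* r)) :+ r) ≡.refl j q r

  1+[j+[2+q]*r]≡1+[j+q*r]+2r : suc (j ℕ.+ suc (suc q) ℕ.* r) ≡ suc (j ℕ.+ q ℕ.* r) ℕ.+ 2 ℕ.* r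
  1+[j+[2+q]*r]≡1+[j+q*r]+2r =
    solve 3 (λ j q r → con 1 :+ (j :+ (con 2 :+ q) :* r) := (con 1 :+ (j :+ q :* r)) :+ con 2 :* r) ≡.refl j q r

module RingIdentities {c ℓ : Level} (R : CommutativeRing c ℓ) where
  R′ : AlmostCommutativeRing c ℓ
  R′ = fromCommutativeRing R (λ _ → nothing)
  open AlmostCommutativeRing R′

  *-distribˡ-+-rearranged : ∀ p a b x y → p * (a * x + b * y) ≈ (p * x) * a + (p * y) * b
  *-distribˡ-+-rearranged = solve-∀ R′

module LucasProperties {c ℓ : Level} (R : CommutativeRing c ℓ) (s : ℕ → CommutativeRing.Carrier R) where
  open CommutativeRing R
  open Lucas R s
  open RingProperties ring using (-‿distribʳ-*; -‿+-comm)
  open RingIdentities R using (*-distribˡ-+-rearranged)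
  open import Algebra.Properties.CommutativeSemigroup +-commutativeSemigroup using (interchange)
  open import Relation.Binary.Reasoning.Setoid setoid

  ≡⇒≈ : ∀ {x y} → x ≡ y → x ≈ y
  ≡⇒≈ ≡.refl = refl

  weightSum : List TilingWord → Carrier
  weightSum ws = sumL (map wt ws)

  wt-replicate-++ : ∀ n w → wt (replicate n 1 ++ w) ≈ pow (s 1) n * wt w
  wt-replicate-++ zero w = sym (*-identityˡ _)
  wt-replicate-++ (suc n) w = trans (*-congˡ (wt-replicate-++ n w)) (sym (*-assoc _ _ _))

  weightSum-replicate-++ : ∀ n ws → weightSum (map (replicate n 1 ++_) ws) ≈ pow (s 1) n * weightSum ws
  weightSum-replicate-++ n [] = sym (zeroʳ _)
  weightSum-replicate-++ n (w ∷ ws) =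
    trans (+-cong (wt-replicate-++ n w) (weightSum-replicate-++ n ws)) (sym (distribˡ _ _ _))

  weightSum-∷ : ∀ a ws → weightSum (map (a ∷_) ws) ≈ s a * weightSum ws
  weightSum-∷ a [] = sym (zeroʳ _)
  weightSum-∷ a (w ∷ ws) = trans (+-congˡ (weightSum-∷ a ws)) (sym (distribˡ _ _ _))

  weightSum-++ : ∀ ws vs → weightSum (ws ++ vs) ≈ weightSum ws + weightSum vs
  weightSum-++ [] vs = sym (+-identityˡ _)
  weightSum-++ (w ∷ ws) vs = trans (+-congˡ (weightSum-++ ws vs)) (sym (+-assoc _ _ _))

  module _ (a b : ℕ) where

    wordsWeight : ℕ → Carrier
    wordsWeight q = weightSum (words12 a b q)

    wordsWeight-0 : wordsWeight 0 ≈ 1#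
    wordsWeight-0 = +-identityʳ _

    wordsWeight-1 : wordsWeight 1 ≈ s a
    wordsWeight-1 = trans (+-identityʳ _) (*-identityʳ _)

    wordsWeight-2+ : ∀ q → wordsWeight (suc (suc q)) ≈ s a * wordsWeight (suc q) + s b * wordsWeight q
    wordsWeight-2+ q = trans (weightSum-++ (map (a ∷_) (words12 a b (suc q))) (map (b ∷_) (words12 a b q)))
                             (+-cong (weightSum-∷ a (words12 a b (suc q))) (weightSum-∷ b (words12 a b q)))

  sumTo-cong : ∀ N {f g : ℕ → Carrier} → (∀ i → f i ≈ g i) → sumTo N f ≈ sumTo N g
  sumTo-cong zero f≈g = refl
  sumTo-cong (suc N) f≈g = +-cong (sumTo-cong N f≈g) (f≈g N)

  sumTo-- : ∀ N (f g : ℕ → Carrier) → sumTo N (λ i → f i - g i) ≈ sumTo N f - sumTo N g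
  sumTo-- zero f g = sym (-‿inverseʳ 0#)
  sumTo-- (suc N) f g = begin
    sumTo N (λ i → f i - g i) + (f N - g N)     ≈⟨ +-congʳ (sumTo-- N f g) ⟩
    (sumTo N f - sumTo N g) + (f N - g N)       ≈⟨ interchange (sumTo N f) (- sumTo N g) (f N) (- g N) ⟩
    (sumTo N f + f N) + (- sumTo N g + - g N)   ≈⟨ +-congˡ (-‿+-comm _ _) ⟩
    (sumTo N f + f N) - (sumTo N g + g N)       ∎

  sumTo-zero : ∀ N (f : ℕ → Carrier) → (∀ i → i < N → f i ≈ 0#) → sumTo N f ≈ 0#
  sumTo-zero zero f f≈0 = refl
  sumTo-zero (suc N) f f≈0 =
    trans (+-cong (sumTo-zero N f (λ i i<N → f≈0 i (ℕₚ.m<n⇒m<1+n i<N))) (f≈0 N ℕₚ.≤-refl)) (+-identityʳ _)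

  sumTo-single : ∀ N (f : ℕ → Carrier) {p} → p < N → (∀ i → i < N → i ≢ p → f i ≈ 0#) → sumTo N f ≈ f p
  sumTo-single (suc N) f {p} p<1+N f≈0 with p ≟ N
  ... | yes ≡.refl = trans (+-congʳ (sumTo-zero N f (λ i i<N → f≈0 i (ℕₚ.m<n⇒m<1+n i<N) (ℕₚ.<⇒≢ i<N))))
                           (+-identityˡ _)
  ... | no p≢N = trans (+-cong (sumTo-single N f (ℕₚ.≤∧≢⇒< (ℕₚ.≤-pred p<1+N) p≢N)
                                              (λ i i<N → f≈0 i (ℕₚ.m<n⇒m<1+n i<N)))
                               (f≈0 N ℕₚ.≤-refl (p≢N ∘ ≡.sym)))
                       (+-identityʳ _)

  mono-≡ : ∀ a n → mono a n n ≡ a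
  mono-≡ a n with n ≟ n
  ... | yes _ = ≡.refl
  ... | no n≢n = ⊥-elim (n≢n ≡.refl)

  mono-≢ : ∀ a n {k} → k ≢ n → mono a n k ≡ 0#
  mono-≢ a n {k} k≢n with k ≟ n
  ... | yes k≡n = ⊥-elim (k≢n k≡n)
  ... | no _ = ≡.refl

  ⋆-⊖ : ∀ f g h k → (f ⋆ (g ⊖ h)) k ≈ (f ⋆ g) k - (f ⋆ h) k
  ⋆-⊖ f g h k =
    trans (sumTo-cong (suc k) (λ i → trans (distribˡ _ _ _) (+-congˡ (sym (-‿distribʳ-* _ _)))))
          (sumTo-- (suc k) _ _)

  ⋆-mono-≤ : ∀ f a {n k} → n ≤ k → (f ⋆ mono a n) k ≈ f (k ∸ n) * a
  ⋆-mono-≤ f a {n} {k} n≤k = begin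
    (f ⋆ mono a n) k                   ≈⟨ sumTo-single (suc k) _ (s≤s (ℕₚ.m∸n≤m k n)) off-diagonal ⟩
    f (k ∸ n) * mono a n (k ∸ (k ∸ n)) ≡⟨ ≡.cong (λ i → f (k ∸ n) * mono a n i) (ℕₚ.m∸[m∸n]≡n n≤k) ⟩
    f (k ∸ n) * mono a n n             ≡⟨ ≡.cong (f (k ∸ n) *_) (mono-≡ a n) ⟩
    f (k ∸ n) * a                      ∎
    where
    off-diagonal : ∀ i → i < suc k → i ≢ k ∸ n → f i * mono a n (k ∸ i) ≈ 0#
    off-diagonal i i≤k i≢k∸n = trans (*-congˡ (≡⇒≈ (mono-≢ a n k∸i≢n))) (zeroʳ _)
      where
      k∸i≢n : k ∸ i ≢ n
      k∸i≢n k∸i≡n = i≢k∸n (≡.trans (≡.sym (ℕₚ.m∸[m∸n]≡n (ℕₚ.≤-pred i≤k))) (≡.cong (k ∸_) k∸i≡n))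

  ⋆-mono-< : ∀ f a {n k} → k < n → (f ⋆ mono a n) k ≈ 0#
  ⋆-mono-< f a {n} {k} k<n = sumTo-zero (suc k) _ λ i _ →
    trans (*-congˡ (≡⇒≈ (mono-≢ a n (λ k∸i≡n → ℕₚ.<⇒≱ k<n (≡.subst (_≤ k) k∸i≡n (ℕₚ.m∸n≤m k i))))))
          (zeroʳ _)

  module _ (r : ℕ) .{{_ : NonZero r}} where

    W : ℕ → Carrier
    W = wordsWeight r (2 ℕ.* r)

    recurrenceRHS : ℕ → Carrier
    recurrenceRHS m = lucℤ r (+ m ℤ.- + r) * s r + lucℤ r (+ m ℤ.- + (2 ℕ.* r)) * s (2 ℕ.* r)

    luc-1+[j+q*r] : ∀ {j} → j < r → ∀ q → luc r (suc (j ℕ.+ q ℕ.* r)) ≈ pow (s 1) j * W q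
    luc-1+[j+q*r] {j} j<r q = begin
      luc r (suc n)                  ≈⟨ weightSum-replicate-++ (n % r) (words12 r (2 ℕ.* r) (n / r)) ⟩
      pow (s 1) (n % r) * W (n / r)
        ≡⟨ ≡.cong₂ (λ i p → pow (s 1) i * W p) ([j+q*r]%r≡j r j<r q) ([j+q*r]/r≡q r j<r q) ⟩
      pow (s 1) j * W q              ∎
      where n = j ℕ.+ q ℕ.* r

    luc-≤ : ∀ i → 1 ≤ i → i ≤ r → luc r i ≈ pow (s 1) (i ∸ 1)
    luc-≤ (suc i) _ i<r = begin
      luc r (suc i)                     ≡⟨ ≡.cong (λ n → luc r (suc n)) (≡.sym (ℕₚ.+-identityʳ i)) ⟩
      luc r (suc (i ℕ.+ 0 ℕ.* r))       ≈⟨ luc-1+[j+q*r] i<r 0 ⟩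
      pow (s 1) i * W 0                 ≈⟨ *-congˡ (wordsWeight-0 r (2 ℕ.* r)) ⟩
      pow (s 1) i * 1#                  ≈⟨ *-identityʳ _ ⟩
      pow (s 1) i                       ∎

    lucℤ-≥ : ∀ {m n} → n ≤ m → lucℤ r (+ m ℤ.- + n) ≡ luc r (m ∸ n)
    lucℤ-≥ {m} {n} n≤m rewrite ℤₚ.m-n≡m⊖n m n | ℤₚ.⊖-≥ n≤m = ≡.refl

    lucℤ-[n+d]-d : ∀ n d → lucℤ r (+ (n ℕ.+ d) ℤ.- + d) ≡ luc r n
    lucℤ-[n+d]-d n d = ≡.trans (lucℤ-≥ (ℕₚ.m≤n+m d n)) (≡.cong (luc r) (ℕₚ.m+n∸n≡m n d))

    lucℤ-≤ : ∀ {m n} → m ≤ n → lucℤ r (+ m ℤ.- + n) ≈ 0#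
    lucℤ-≤ {m} {n} m≤n rewrite ℤₚ.m-n≡m⊖n m n | ℤₚ.⊖-≤ m≤n = lucℤ-negative (n ∸ m)
      where
      lucℤ-negative : ∀ d → lucℤ r (ℤ.- + d) ≈ 0#
      lucℤ-negative zero = refl
      lucℤ-negative (suc d) = refl

    module _ {j : ℕ} (j<r : j < r) where

      lucℤ-∸r : ∀ q → lucℤ r (+ suc (j ℕ.+ suc q ℕ.* r) ℤ.- + r) ≈ pow (s 1) j * W q
      lucℤ-∸r q = begin
        lucℤ r (+ suc (j ℕ.+ suc q ℕ.* r) ℤ.- + r)
          ≡⟨ ≡.cong (λ m → lucℤ r (+ m ℤ.- + r)) (1+[j+[1+q]*r]≡1+[j+q*r]+r j q r) ⟩
        lucℤ r (+ (suc (j ℕ.+ q ℕ.* r) ℕ.+ r) ℤ.- + r)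
          ≡⟨ lucℤ-[n+d]-d (suc (j ℕ.+ q ℕ.* r)) r ⟩
        luc r (suc (j ℕ.+ q ℕ.* r))
          ≈⟨ luc-1+[j+q*r] j<r q ⟩
        pow (s 1) j * W q
          ∎

      lucℤ-∸2r : ∀ q → lucℤ r (+ suc (j ℕ.+ suc (suc q) ℕ.* r) ℤ.- + (2 ℕ.* r)) ≈ pow (s 1) j * W q
      lucℤ-∸2r q = begin
        lucℤ r (+ suc (j ℕ.+ suc (suc q) ℕ.* r) ℤ.- + (2 ℕ.* r))
          ≡⟨ ≡.cong (λ m → lucℤ r (+ m ℤ.- + (2 ℕ.* r))) (1+[j+[2+q]*r]≡1+[j+q*r]+2r j q r) ⟩
        lucℤ r (+ (suc (j ℕ.+ q ℕ.* r) ℕ.+ 2 ℕ.* r) ℤ.- + (2 ℕ.* r))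
          ≡⟨ lucℤ-[n+d]-d (suc (j ℕ.+ q ℕ.* r)) (2 ℕ.* r) ⟩
        luc r (suc (j ℕ.+ q ℕ.* r))
          ≈⟨ luc-1+[j+q*r] j<r q ⟩
        pow (s 1) j * W q
          ∎

      luc-recurrence-suc : ∀ q → luc r (suc (j ℕ.+ suc q ℕ.* r)) ≈ recurrenceRHS (suc (j ℕ.+ suc q ℕ.* r))
      luc-recurrence-suc zero = begin
        luc r (suc (j ℕ.+ 1 ℕ.* r))                        ≈⟨ luc-1+[j+q*r] j<r 1 ⟩
        pow (s 1) j * W 1                                 ≈⟨ *-congˡ (wordsWeight-1 r (2 ℕ.* r)) ⟩
        pow (s 1) j * s r                                 ≈⟨ *-congʳ (sym (*-identityʳ _)) ⟩
        (pow (s 1) j * 1#) * s r                          ≈⟨ *-congʳ (*-congˡ (sym (wordsWeight-0 r (2 ℕ.* r)))) ⟩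
        (pow (s 1) j * W 0) * s r                         ≈⟨ *-congʳ (sym (lucℤ-∸r 0)) ⟩
        lucℤ r (+ m ℤ.- + r) * s r                        ≈⟨ sym (+-identityʳ _) ⟩
        lucℤ r (+ m ℤ.- + r) * s r + 0#                   ≈⟨ +-congˡ (sym (trans (*-congʳ (lucℤ-≤ m≤2r)) (zeroˡ _))) ⟩
        recurrenceRHS m                                   ∎
        where
        m = suc (j ℕ.+ 1 ℕ.* r)
        m≤2r : m ≤ 2 ℕ.* r
        m≤2r = ℕₚ.+-monoˡ-≤ (r ℕ.+ 0) j<r
      luc-recurrence-suc (suc q) = begin
        luc r (suc (j ℕ.+ suc (suc q) ℕ.* r))                        ≈⟨ luc-1+[j+q*r] j<r (suc (suc q)) ⟩
        pow (s 1) j * W (suc (suc q))                                ≈⟨ *-congˡ (wordsWeight-2+ r (2 ℕ.* r) q) ⟩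
        pow (s 1) j * (s r * W (suc q) + s (2 ℕ.* r) * W q)          ≈⟨ *-distribˡ-+-rearranged _ _ _ _ _ ⟩
        (pow (s 1) j * W (suc q)) * s r + (pow (s 1) j * W q) * s (2 ℕ.* r)
          ≈⟨ +-cong (*-congʳ (sym (lucℤ-∸r (suc q)))) (*-congʳ (sym (lucℤ-∸2r q))) ⟩
        recurrenceRHS (suc (j ℕ.+ suc (suc q) ℕ.* r))                ∎

    luc-recurrence : ∀ m → r < m → luc r m ≈ recurrenceRHS m
    luc-recurrence (suc n) (s≤s r≤n) =
      ≡.subst (λ n → luc r (suc n) ≈ recurrenceRHS (suc n)) (≡.sym n≡n%r+[1+q]*r)
              (luc-recurrence-suc (DivMod.m%n<n n r) q)
      where
      q = (n ∸ r) / r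
      n≡n%r+[1+q]*r : n ≡ n % r ℕ.+ suc q ℕ.* r
      n≡n%r+[1+q]*r = ≡.trans (DivMod.m≡m%n+[m/n]*n n r)
                              (≡.cong (λ p → n % r ℕ.+ p ℕ.* r) (DivMod.m/n≡1+[m∸n]/n r≤n))

    genFun-⋆-mono : ∀ a n k → (genFun r ⋆ mono a n) k ≈ lucℤ r (+ k ℤ.- + n) * a
    genFun-⋆-mono a n k with n ≤? k
    ... | yes n≤k = trans (⋆-mono-≤ (genFun r) a n≤k) (*-congʳ (≡⇒≈ (≡.sym (lucℤ-≥ n≤k))))
    ... | no n≰k = trans (⋆-mono-< (genFun r) a k<n) (sym (trans (*-congʳ (lucℤ-≤ (ℕₚ.<⇒≤ k<n))) (zeroˡ a)))
      where k<n = ℕₚ.≰⇒> n≰k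

    genFun-⋆-denom : ∀ k → (genFun r ⋆ denom r) k ≈ luc r k - recurrenceRHS k
    genFun-⋆-denom k = begin
      (genFun r ⋆ denom r) k
        ≈⟨ ⋆-⊖ (genFun r) (mono 1# 0 ⊖ mono (s r) r) (mono (s (2 ℕ.* r)) (2 ℕ.* r)) k ⟩
      (genFun r ⋆ (mono 1# 0 ⊖ mono (s r) r)) k - (genFun r ⋆ mono (s (2 ℕ.* r)) (2 ℕ.* r)) k
        ≈⟨ +-congʳ (⋆-⊖ (genFun r) (mono 1# 0) (mono (s r) r) k) ⟩
      ((genFun r ⋆ mono 1# 0) k - (genFun r ⋆ mono (s r) r) k) - (genFun r ⋆ mono (s (2 ℕ.* r)) (2 ℕ.* r)) k
        ≈⟨ +-cong (+-cong (genFun-⋆-mono 1# 0 k) (-‿cong (genFun-⋆-mono (s r) r k)))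
                  (-‿cong (genFun-⋆-mono (s (2 ℕ.* r)) (2 ℕ.* r) k)) ⟩
      (lucℤ r (+ k ℤ.- + 0) * 1# - lucℤ r (+ k ℤ.- + r) * s r) - lucℤ r (+ k ℤ.- + (2 ℕ.* r)) * s (2 ℕ.* r)
        ≈⟨ +-congʳ (+-congʳ (trans (*-identityʳ _) (≡⇒≈ (lucℤ-≥ {k} z≤n)))) ⟩
      (luc r k - lucℤ r (+ k ℤ.- + r) * s r) - lucℤ r (+ k ℤ.- + (2 ℕ.* r)) * s (2 ℕ.* r)
        ≈⟨ +-assoc _ _ _ ⟩
      luc r k + (- (lucℤ r (+ k ℤ.- + r) * s r) - lucℤ r (+ k ℤ.- + (2 ℕ.* r)) * s (2 ℕ.* r))
        ≈⟨ +-congˡ (-‿+-comm _ _) ⟩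
      luc r k - recurrenceRHS k
        ∎

    recurrenceRHS-≤ : ∀ {k} → k ≤ r → recurrenceRHS k ≈ 0#
    recurrenceRHS-≤ k≤r = begin
      recurrenceRHS _              ≈⟨ +-cong (*-congʳ (lucℤ-≤ k≤r)) (*-congʳ (lucℤ-≤ k≤2r)) ⟩
      0# * s r + 0# * s (2 ℕ.* r)  ≈⟨ +-cong (zeroˡ _) (zeroˡ _) ⟩
      0# + 0#                      ≈⟨ +-identityʳ 0# ⟩
      0#                           ∎
      where
      k≤2r = ℕₚ.≤-trans k≤r (ℕₚ.m≤m+n r (r ℕ.+ 0))

    numer-≤ : ∀ k → k ≤ r → numer r k ≈ luc r k
    numer-≤ zero _ = sumTo-zero r _ (λ i _ → ≡⇒≈ (mono-≢ (pow (s 1) i) (suc i) {0} λ ()))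
    numer-≤ (suc k) k<r = begin
      numer r (suc k)
        ≈⟨ sumTo-single r _ k<r (λ i _ i≢k → ≡⇒≈ (mono-≢ _ (suc i) (i≢k ∘ ≡.sym ∘ ℕₚ.suc-injective))) ⟩
      mono (pow (s 1) k) (suc k) (suc k)  ≡⟨ mono-≡ (pow (s 1) k) (suc k) ⟩
      pow (s 1) k                         ≈⟨ luc-≤ (suc k) (s≤s z≤n) k<r ⟨
      luc r (suc k)                       ∎

    numer-> : ∀ k → r < k → numer r k ≈ 0#
    numer-> k r<k = sumTo-zero r _ λ i i<r →
      ≡⇒≈ (mono-≢ _ (suc i) (λ k≡1+i → ℕₚ.<⇒≱ r<k (≡.subst (_≤ r) (≡.sym k≡1+i) i<r)))

lemma2p1 : ∀ {c ℓ : Level} (R : CommutativeRing c ℓ) (s : ℕ → CommutativeRing.Carrier R)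
           (r : ℕ) .{{_ : NonZero r}} →
           let open CommutativeRing R
               open Lucas R s
           in
           (luc r 0 ≈ 0#)
           × (∀ (i : ℕ) → 1 ≤ i → i ≤ r → luc r i ≈ pow (s 1) (i ∸ 1))
           × (∀ (m : ℕ) → r < m →
                luc r m ≈ (lucℤ r (+ m ℤ.- + r) * s r + lucℤ r (+ m ℤ.- + (2 ℕ.* r)) * s (2 ℕ.* r)))
           × (∀ (k : ℕ) → (genFun r ⋆ denom r) k ≈ numer r k)
lemma2p1 R s r = refl , luc-≤ r , luc-recurrence r , generatingFunction
  where
  open CommutativeRing R
  open Lucas R s
  open LucasProperties R s
  open RingProperties ring using (-0#≈0#; x≈y⇒x∙y⁻¹≈ε)
  open import Relation.Binary.Reasoning.Setoid setoid

  generatingFunction : ∀ k → (genFun r ⋆ denom r) k ≈ numer r k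
  generatingFunction k with k ≤? r
  ... | yes k≤r = begin
    (genFun r ⋆ denom r) k       ≈⟨ genFun-⋆-denom r k ⟩
    luc r k - recurrenceRHS r k  ≈⟨ +-congˡ (trans (-‿cong (recurrenceRHS-≤ r k≤r)) -0#≈0#) ⟩
    luc r k + 0#                 ≈⟨ +-identityʳ _ ⟩
    luc r k                      ≈⟨ numer-≤ r k k≤r ⟨
    numer r k                    ∎
  ... | no k≰r = begin
    (genFun r ⋆ denom r) k       ≈⟨ genFun-⋆-denom r k ⟩
    luc r k - recurrenceRHS r k  ≈⟨ x≈y⇒x∙y⁻¹≈ε (luc-recurrence r k r<k) ⟩
    0#                           ≈⟨ numer-> r k r<k ⟨
    numer r k                    ∎
    where r<k = ℕₚ.≰⇒> k≰r
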